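{- Let $S$ be a $2$-separation of a matching covered graph $G$. If $G-S$ has three or more components, then $G$ is $\theta$-based.
   Context: Graphs loopless; multiple edges allowed. A connected graph with at least two vertices is matching covered if every edge lies in a perfect matching. A barrier of a graph with a perfect matching is a set $B$ of vertices such that the number of odd components of $G-B$ equals $|B|$. A $2$-separation of a matching covered graph is a set $S$ of two vertices such that $G-S$ is disconnected and $S$ is not a barrier. $\theta$ is two vertices joined by three parallel edges. A subgraph $H$ of $G$ is conformal if $G-V(H)$ has a perfect matching; $G$ is $\theta$-based if it has a conformal subgraph that is a bisubdivision of $\theta$ (obtained by replacing some edges of $\theta$ by paths with an even number of internal vertices). -}

module Defs where

open import Data.Nat using (ℕ; suc; _≤_; _*_)
open import Data.Bool using (Bool; true; false; not; _∧_)
open import Data.Fin using (Fin; zero; suc; inject₁; fromℕ; _≟_)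
open import Data.Fin.Subset using (Subset; _∈_; _∉_; ∣_∣)
open import Data.Vec using (lookup; tabulate)
open import Data.Product using (_×_; Σ; ∃; ∃-syntax; proj₁; proj₂; _,_)
open import Data.Sum using (_⊎_)
open import Data.Unit using (⊤)
open import Function.Definitions using (Injective)
open import Relation.Binary.PropositionalEquality using (_≡_; _≢_)
open import Relation.Nullary using (¬_)
open import Relation.Nullary.Decidable using (⌊_⌋)

-- A finite loopless multigraph: vertices Fin n, edges Fin m,
-- each edge has two (distinct) ends.  Parallel edges are allowed.
record Graph : Set where
  field
    n    : ℕ
    m    : ℕ
    ends : Fin m → Fin n × Fin n
    loopless : ∀ e → proj₁ (ends e) ≢ proj₂ (ends e)

module _ (G : Graph) where
  open Graph G

  Joins : Fin m → Fin n → Fin n → Set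
  Joins e u w = (proj₁ (ends e) ≡ u × proj₂ (ends e) ≡ w)
              ⊎ (proj₁ (ends e) ≡ w × proj₂ (ends e) ≡ u)

  Incident : Fin m → Fin n → Set
  Incident e v = proj₁ (ends e) ≡ v ⊎ proj₂ (ends e) ≡ v

  data Reach (X : Fin n → Set) : Fin n → Fin n → Set where
    here : ∀ {u} → X u → Reach X u u
    step : ∀ {u w v} (e : Fin m) → X u → Joins e u w → Reach X w v → Reach X u v

  PerfectMatchingOn : (X : Fin n → Set) → Subset m → Set
  PerfectMatchingOn X M =
      (∀ e → e ∈ M → X (proj₁ (ends e)) × X (proj₂ (ends e)))
    × (∀ v → X v → ∃[ e ] (e ∈ M × Incident e v))
    × (∀ v e e' → e ∈ M → e' ∈ M → Incident e v → Incident e' v → e ≡ e')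

  IsPerfectMatching : Subset m → Set
  IsPerfectMatching M = PerfectMatchingOn (λ _ → ⊤) M

  Connected₂ : Set
  Connected₂ = (2 ≤ n) × (∀ u v → Reach (λ _ → ⊤) u v)

  MatchingCovered : Set
  MatchingCovered = Connected₂ × (∀ e → ∃[ M ] (IsPerfectMatching M × e ∈ M))

  Outside : Subset n → Fin n → Set
  Outside B v = v ∉ B

  -- c : Fin n → Fin k labels the components of G - B:
  -- every label is used by a vertex of G - B, and two vertices of G - B
  -- get the same label iff they lie in the same component of G - B.
  ComponentLabelling : (B : Subset n) (k : ℕ) → (Fin n → Fin k) → Set
  ComponentLabelling B k c =
      (∀ i → ∃[ v ] (v ∉ B × c v ≡ i))
    × (∀ u v → u ∉ B → v ∉ B → (c u ≡ c v → Reach (Outside B) u v)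
                              × (Reach (Outside B) u v → c u ≡ c v))

  isOdd : ℕ → Bool
  isOdd 0 = false
  isOdd (suc k) = not (isOdd k)

  componentOf : (B : Subset n) {k : ℕ} → (Fin n → Fin k) → Fin k → Subset n
  componentOf B c i = tabulate (λ v → not (lookup B v) ∧ ⌊ c v ≟ i ⌋)

  oddComponents : (B : Subset n) (k : ℕ) → (Fin n → Fin k) → ℕ
  oddComponents B k c = ∣ tabulate (λ i → isOdd ∣ componentOf B c i ∣) ∣

  Barrier : Subset n → Set
  Barrier B = ∃[ k ] ∃[ c ] (ComponentLabelling B k c × oddComponents B k c ≡ ∣ B ∣)

  TwoSeparation : Subset n → Set
  TwoSeparation S =
      ∣ S ∣ ≡ 2
    × (∃[ u ] ∃[ v ] (u ∉ S × v ∉ S × ¬ Reach (Outside S) u v))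
    × ¬ Barrier S

  AtLeastThreeComponents : Subset n → Set
  AtLeastThreeComponents S =
    ∃[ u ] ∃[ v ] ∃[ w ] (u ∉ S × v ∉ S × w ∉ S
      × ¬ Reach (Outside S) u v × ¬ Reach (Outside S) u w × ¬ Reach (Outside S) v w)

  record Path (L : ℕ) (a b : Fin n) : Set where
    field
      verts : Fin (suc L) → Fin n
      verts-inj : Injective _≡_ _≡_ verts
      start : verts zero ≡ a
      finish : verts (fromℕ L) ≡ b
      edges : Fin L → Fin m
      edges-join : ∀ i → Joins (edges i) (verts (inject₁ i)) (verts (suc i))

  record ConformalBisubdivisionOfθ : Set where
    field
      a b : Fin n
      a≢b : a ≢ b
      len : Fin 3 → ℕ
      len-odd : ∀ j → ∃[ t ] (len j ≡ suc (2 * t))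
      path : (j : Fin 3) → Path (len j) a b
      internally-disjoint : ∀ j j' → j ≢ j' → ∀ i i' →
        Path.verts (path j) i ≡ Path.verts (path j') i' →
        (Path.verts (path j) i ≡ a ⊎ Path.verts (path j) i ≡ b)
      edge-disjoint : ∀ j j' → j ≢ j' → ∀ i i' →
        Path.edges (path j) i ≢ Path.edges (path j') i'

    InH : Fin n → Set
    InH v = ∃[ j ] ∃[ i ] (Path.verts (path j) i ≡ v)

    field
      conformal : ∃[ M ] PerfectMatchingOn (λ v → ¬ InH v) M

  θ-based : Set
  θ-based = ConformalBisubdivisionOfθ

-- Write S = {s, t} and let C₀, C₁, C₂ be three components of G − S. An edge between S and Cⱼ lies in a
-- perfect matching Mⱼ, which matches a vertex of S into Cⱼ; as S is not a barrier, Mⱼ matches both s and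
-- t into Cⱼ, since otherwise the components receiving s and t would be the only odd components of G − S.
-- Hence Mⱼ₊₁ matches Cⱼ within itself, so the walk from s alternating between Mⱼ- and Mⱼ₊₁-edges stays
-- in Cⱼ until it leaves by an Mⱼ-edge, necessarily towards t: an odd path Pⱼ from s to t through Cⱼ,
-- and Mⱼ still matches Cⱼ − Pⱼ within itself. So P₀ ∪ P₁ ∪ P₂ bisubdivides θ, and its complement is
-- perfectly matched by Mⱼ on each Cⱼ and by M₀ on the rest of the graph.

module Submission where

open import Defs
open import Data.Bool using (Bool; true; false; not; _∧_)
open import Data.Bool.Properties using (not-involutive; not-injective; ¬-not) renaming (_≟_ to _≟ᵇ_)
open import Data.Empty using (⊥; ⊥-elim)
open import Data.Fin using (Fin; zero; suc; toℕ; fromℕ<; inject₁; _≟_)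
open import Data.Fin.Properties
  using (any?; all?; pigeonhole; toℕ-injective; toℕ<n; toℕ≤pred[n]; toℕ-fromℕ; toℕ-fromℕ<; toℕ-inject₁)
open import Data.Fin.Subset using (Subset; inside; outside; _∈_; _∉_; _-_; _∪_; ⁅_⁆; ∣_∣; Nonempty)
open import Data.Fin.Subset.Properties
  using (_∈?_; ∣⊥∣≡0; ∣⁅x⁆∣≡1; Empty-unique; nonempty?; ⊆-antisym; ∪-identityʳ; p─⊥≡p; p─q⊆p;
         x∈⁅x⁆; x∈⁅y⁆⇒x≡y; x≢y⇒x∉⁅y⁆; x∈p∪q⁺; x∈p∪q⁻; x∈p∧x≢y⇒x∈p-y)
open import Data.Nat using (ℕ; zero; suc; _+_; _*_; _≤_; _<_; z≤n; s≤s; z<s; s≤s⁻¹)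
open import Data.Nat.Divisibility using (_∣_; divides; _∣0; ∣m∣n⇒∣m+n; ∣-refl)
open import Data.Nat.Induction using (<-rec)
open import Data.Nat.Properties
  using (m<n+m; suc-injective; n<1+n; <-trans; ≤-refl; ≤-trans; n≤1+n; m≤n⇒m<n∨m≡n; <-cmp; ≤∧≢⇒<; *-suc)
open import Data.Product using (Σ; ∃; ∃₂; ∃-syntax; _×_; _,_; proj₁; proj₂)
open import Data.Sum using (_⊎_; inj₁; inj₂)
open import Data.Unit using (⊤; tt)
open import Data.Vec using (_∷_; here; there; lookup; tabulate)
open import Data.Vec.Properties using (lookup∘tabulate; lookup⇒[]=; []=⇒lookup)
open import Function using (_∘_)
open import Level using (0ℓ)
open import Relation.Binary using (Rel; Symmetric; Transitive; tri<; tri≈; tri>)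
open import Relation.Nullary using (¬_; Dec; yes; no; contradiction; ¬?; _×-dec_; _⊎-dec_; _→-dec_)
open import Relation.Nullary.Decidable using (⌊_⌋; isYes≗does; dec-true; decidable-stable)
open import Relation.Unary using (Pred; Decidable)
open import Relation.Binary.PropositionalEquality

module _ where

  private
    variable
      N : ℕ
      x y z : Fin N
      p : Subset N

  x∈p-y⇒x∈p : x ∈ p - y → x ∈ p
  x∈p-y⇒x∈p {p = p} {y = y} = p─q⊆p p ⁅ y ⁆

  x∉p-x : ∀ (x : Fin N) p → x ∉ p - x
  x∉p-x zero    (_ ∷ p) ()
  x∉p-x (suc x) (_ ∷ p) (there x∈p-x) = x∉p-x x p x∈p-x

  x∈p-y⇒x≢y : x ∈ p - y → x ≢ y
  x∈p-y⇒x≢y {x = x} {p = p} x∈p-y refl = x∉p-x x p x∈p-y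

  x∈p⇒∣p∣≡1+∣p-x∣ : x ∈ p → ∣ p ∣ ≡ suc ∣ p - x ∣
  x∈p⇒∣p∣≡1+∣p-x∣ {x = zero} {p = inside ∷ p} here        = cong (suc ∘ ∣_∣) (sym (p─⊥≡p p))
  x∈p⇒∣p∣≡1+∣p-x∣ {x = suc x} {p = outside ∷ p} (there x∈p) = x∈p⇒∣p∣≡1+∣p-x∣ x∈p
  x∈p⇒∣p∣≡1+∣p-x∣ {x = suc x} {p = inside ∷ p} (there x∈p) = cong suc (x∈p⇒∣p∣≡1+∣p-x∣ x∈p)

  x∉p⇒∣p∪⁅x⁆∣≡1+∣p∣ : x ∉ p → ∣ p ∪ ⁅ x ⁆ ∣ ≡ suc ∣ p ∣
  x∉p⇒∣p∪⁅x⁆∣≡1+∣p∣ {x = zero} {p = outside ∷ p} _   = cong (suc ∘ ∣_∣) (∪-identityʳ p)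
  x∉p⇒∣p∪⁅x⁆∣≡1+∣p∣ {x = zero} {p = inside ∷ p} x∉p = contradiction here x∉p
  x∉p⇒∣p∪⁅x⁆∣≡1+∣p∣ {x = suc x} {p = outside ∷ p} x∉p = x∉p⇒∣p∪⁅x⁆∣≡1+∣p∣ (x∉p ∘ there)
  x∉p⇒∣p∪⁅x⁆∣≡1+∣p∣ {x = suc x} {p = inside ∷ p} x∉p = cong suc (x∉p⇒∣p∪⁅x⁆∣≡1+∣p∣ (x∉p ∘ there))

  ∣p∣≡1+n⇒Nonempty : ∀ {k n} {p : Subset k} → ∣ p ∣ ≡ suc n → Nonempty p
  ∣p∣≡1+n⇒Nonempty {k} {p = p} ∣p∣≡1+n with nonempty? p
  ... | yes ne = ne
  ... | no ¬ne = contradiction (trans (sym ∣p∣≡1+n) (trans (cong ∣_∣ (Empty-unique ¬ne)) (∣⊥∣≡0 k))) λ ()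

  x∈⁅x⁆∪⁅y⁆ : ∀ (x y : Fin N) → x ∈ ⁅ x ⁆ ∪ ⁅ y ⁆
  x∈⁅x⁆∪⁅y⁆ x y = x∈p∪q⁺ (inj₁ (x∈⁅x⁆ x))

  y∈⁅x⁆∪⁅y⁆ : ∀ (x y : Fin N) → y ∈ ⁅ x ⁆ ∪ ⁅ y ⁆
  y∈⁅x⁆∪⁅y⁆ x y = x∈p∪q⁺ (inj₂ (x∈⁅x⁆ y))

  z∈⁅x⁆∪⁅y⁆⇒z≡x⊎z≡y : z ∈ ⁅ x ⁆ ∪ ⁅ y ⁆ → z ≡ x ⊎ z ≡ y
  z∈⁅x⁆∪⁅y⁆⇒z≡x⊎z≡y {x = x} {y = y} z∈ with x∈p∪q⁻ ⁅ x ⁆ ⁅ y ⁆ z∈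
  ... | inj₁ z∈⁅x⁆ = inj₁ (x∈⁅y⁆⇒x≡y x z∈⁅x⁆)
  ... | inj₂ z∈⁅y⁆ = inj₂ (x∈⁅y⁆⇒x≡y y z∈⁅y⁆)

  ∣⁅x⁆∪⁅y⁆∣≡2 : x ≢ y → ∣ ⁅ x ⁆ ∪ ⁅ y ⁆ ∣ ≡ 2
  ∣⁅x⁆∪⁅y⁆∣≡2 {x = x} x≢y =
    trans (x∉p⇒∣p∪⁅x⁆∣≡1+∣p∣ (x≢y⇒x∉⁅y⁆ (x≢y ∘ sym))) (cong suc (∣⁅x⁆∣≡1 x))

  p≡⁅x⁆∪⁅y⁆ : x ∈ p → y ∈ p → (∀ {z} → z ∈ p → z ≡ x ⊎ z ≡ y) →
              p ≡ ⁅ x ⁆ ∪ ⁅ y ⁆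
  p≡⁅x⁆∪⁅y⁆ {x = x} {p = p} {y = y} x∈p y∈p only-x-y = ⊆-antisym p⊆ ⊆p
    where
    p⊆ : ∀ {z} → z ∈ p → z ∈ ⁅ x ⁆ ∪ ⁅ y ⁆
    p⊆ z∈p with only-x-y z∈p
    ... | inj₁ refl = x∈⁅x⁆∪⁅y⁆ x y
    ... | inj₂ refl = y∈⁅x⁆∪⁅y⁆ x y
    ⊆p : ∀ {z} → z ∈ ⁅ x ⁆ ∪ ⁅ y ⁆ → z ∈ p
    ⊆p z∈ with z∈⁅x⁆∪⁅y⁆⇒z≡x⊎z≡y z∈
    ... | inj₁ refl = x∈p
    ... | inj₂ refl = y∈p

  ∣p∣≡2⇒p≡⁅x⁆∪⁅y⁆ : ∣ p ∣ ≡ 2 → ∃₂ λ x y → x ≢ y × p ≡ ⁅ x ⁆ ∪ ⁅ y ⁆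
  ∣p∣≡2⇒p≡⁅x⁆∪⁅y⁆ {p = p} ∣p∣≡2 with ∣p∣≡1+n⇒Nonempty ∣p∣≡2
  ... | x , x∈p with ∣p∣≡1+n⇒Nonempty ∣p-x∣≡1
    where
    ∣p-x∣≡1 : ∣ p - x ∣ ≡ 1
    ∣p-x∣≡1 = suc-injective (trans (sym (x∈p⇒∣p∣≡1+∣p-x∣ x∈p)) ∣p∣≡2)
  ... | y , y∈p-x = x , y , ≢-sym (x∈p-y⇒x≢y {p = p} y∈p-x) , p≡⁅x⁆∪⁅y⁆ x∈p (x∈p-y⇒x∈p {y = x} y∈p-x) only-x-y
    where
    ∣p-x-y∣≡0 : ∣ p - x - y ∣ ≡ 0
    ∣p-x-y∣≡0 = suc-injective (suc-injective
      (trans (sym (trans (x∈p⇒∣p∣≡1+∣p-x∣ x∈p) (cong suc (x∈p⇒∣p∣≡1+∣p-x∣ y∈p-x)))) ∣p∣≡2))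
    only-x-y : ∀ {z} → z ∈ p → z ≡ x ⊎ z ≡ y
    only-x-y {z} z∈p with z ≟ x | z ≟ y
    ... | yes z≡x | _       = inj₁ z≡x
    ... | no _    | yes z≡y = inj₂ z≡y
    ... | no z≢x  | no z≢y  = contradiction
      (trans (sym ∣p-x-y∣≡0) (x∈p⇒∣p∣≡1+∣p-x∣ (x∈p∧x≢y⇒x∈p-y (x∈p∧x≢y⇒x∈p-y z∈p z≢x) z≢y))) λ ()

module _ {k : ℕ} (σ : Fin k → Fin k)
         (σ-involutive : ∀ x → σ (σ x) ≡ x) (σ-fixpoint-free : ∀ x → σ x ≢ x) where

  Closed : Subset k → Set
  Closed p = ∀ {x} → x ∈ p → σ x ∈ p

  module _ {p : Subset k} {x : Fin k} (closed : Closed p) (x∈p : x ∈ p) where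

    σx∈p-x : σ x ∈ p - x
    σx∈p-x = x∈p∧x≢y⇒x∈p-y (closed x∈p) (σ-fixpoint-free x)

    ∣p∣≡2+∣p-x-σx∣ : ∣ p ∣ ≡ 2 + ∣ p - x - σ x ∣
    ∣p∣≡2+∣p-x-σx∣ = trans (x∈p⇒∣p∣≡1+∣p-x∣ x∈p) (cong suc (x∈p⇒∣p∣≡1+∣p-x∣ σx∈p-x))

    Closed-p-x-σx : Closed (p - x - σ x)
    Closed-p-x-σx {z} z∈p-x-σx = x∈p∧x≢y⇒x∈p-y (x∈p∧x≢y⇒x∈p-y (closed z∈p) σz≢x) σz≢σx
      where
      z∈p-x : z ∈ p - x
      z∈p-x = x∈p-y⇒x∈p {y = σ x} z∈p-x-σx
      z∈p : z ∈ p
      z∈p = x∈p-y⇒x∈p {y = x} z∈p-x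
      σz≢x : σ z ≢ x
      σz≢x σz≡x = x∈p-y⇒x≢y {p = p - x} z∈p-x-σx (trans (sym (σ-involutive z)) (cong σ σz≡x))
      σz≢σx : σ z ≢ σ x
      σz≢σx σz≡σx =
        x∈p-y⇒x≢y {p = p} z∈p-x (trans (sym (σ-involutive z)) (trans (cong σ σz≡σx) (σ-involutive x)))

  Closed⇒2∣∣p∣ : ∀ {p} → Closed p → 2 ∣ ∣ p ∣
  Closed⇒2∣∣p∣ {p} = <-rec (λ j → ∀ {p} → ∣ p ∣ ≡ j → Closed p → 2 ∣ j) even ∣ p ∣ refl
    where
    even : ∀ j → (∀ {i} → i < j → ∀ {p} → ∣ p ∣ ≡ i → Closed p → 2 ∣ i) → ∀ {p} → ∣ p ∣ ≡ j → Closed p → 2 ∣ j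
    even _ rec {p} refl closed with nonempty? p
    ... | no ¬ne = subst (2 ∣_) (sym (trans (cong ∣_∣ (Empty-unique ¬ne)) (∣⊥∣≡0 k))) (2 ∣0)
    ... | yes (x , x∈p) =
      subst (2 ∣_) (sym ∣p∣≡2+∣q∣) (∣m∣n⇒∣m+n ∣-refl (rec ∣q∣<∣p∣ refl (Closed-p-x-σx closed x∈p)))
      where
      ∣p∣≡2+∣q∣ : ∣ p ∣ ≡ 2 + ∣ p - x - σ x ∣
      ∣p∣≡2+∣q∣ = ∣p∣≡2+∣p-x-σx∣ closed x∈p
      ∣q∣<∣p∣ : ∣ p - x - σ x ∣ < ∣ p ∣
      ∣q∣<∣p∣ = subst (∣ p - x - σ x ∣ <_) (sym ∣p∣≡2+∣q∣) (m<n+m _ {2} z<s)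

-- The classes of a partial equivalence relation R, whose domain is {v | R v v}, numbered by Fin k.
record Classes {N : ℕ} (R : Rel (Fin N) 0ℓ) : Set where
  field
    k : ℕ
    class : ∀ {v} → R v v → Fin k
    class-surjective : ∀ i → ∃[ v ] Σ (R v v) λ r → class r ≡ i
    class-≡⇒R : ∀ {u v} (ru : R u u) (rv : R v v) → class ru ≡ class rv → R u v
    R⇒class-≡ : ∀ {u v} (ru : R u u) (rv : R v v) → R u v → class ru ≡ class rv

module _ {N : ℕ} {R : Rel (Fin (suc N)) 0ℓ} (sym : Symmetric R) (trans : Transitive R)
         (rest : Classes (λ u v → R (suc u) (suc v))) where
  open Classes rest

  extend-joining : (R zero zero → ∃ λ j → R zero (suc j)) → Classes R
  extend-joining old = record
    { k = k ; class = class′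
    ; class-surjective = λ i → let v , r , eq = class-surjective i in suc v , r , eq
    ; class-≡⇒R = sound ; R⇒class-≡ = complete }
    where
    rel : (r : R zero zero) → R zero (suc (proj₁ (old r)))
    rel r = proj₂ (old r)
    class′ : ∀ {v} → R v v → Fin k
    class′ {zero}  r = class (trans (sym (rel r)) (rel r))
    class′ {suc v} r = class r
    sound : ∀ {u v} (ru : R u u) (rv : R v v) → class′ ru ≡ class′ rv → R u v
    sound {zero}  {zero}  ru _  _  = ru
    sound {zero}  {suc v} ru rv eq = trans (rel ru) (class-≡⇒R _ rv eq)
    sound {suc u} {zero}  ru rv eq = trans (class-≡⇒R ru _ eq) (sym (rel rv))
    sound {suc u} {suc v} ru rv eq = class-≡⇒R ru rv eq
    complete : ∀ {u v} (ru : R u u) (rv : R v v) → R u v → class′ ru ≡ class′ rv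
    complete {zero}  {zero}  ru rv _ = R⇒class-≡ _ _ (trans (sym (rel ru)) (rel rv))
    complete {zero}  {suc v} ru rv r = R⇒class-≡ _ rv (trans (sym (rel ru)) r)
    complete {suc u} {zero}  ru rv r = R⇒class-≡ ru _ (trans r (rel rv))
    complete {suc u} {suc v} ru rv r = R⇒class-≡ ru rv r

  extend-singleton : R zero zero → (∀ j → ¬ R zero (suc j)) → Classes R
  extend-singleton r00 alone = record
    { k = suc k ; class = class′
    ; class-surjective = surjective
    ; class-≡⇒R = sound ; R⇒class-≡ = complete }
    where
    class′ : ∀ {v} → R v v → Fin (suc k)
    class′ {zero}  _ = zero
    class′ {suc v} r = suc (class r)
    surjective : ∀ i → ∃[ v ] Σ (R v v) λ r → class′ r ≡ i
    surjective zero    = zero , r00 , refl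
    surjective (suc i) = let v , r , eq = class-surjective i in suc v , r , cong suc eq
    sound : ∀ {u v} (ru : R u u) (rv : R v v) → class′ ru ≡ class′ rv → R u v
    sound {zero}  {zero}  ru _  _  = ru
    sound {suc u} {suc v} ru rv eq = class-≡⇒R ru rv (Data.Fin.Properties.suc-injective eq)
    complete : ∀ {u v} (ru : R u u) (rv : R v v) → R u v → class′ ru ≡ class′ rv
    complete {zero}  {zero}  _  _  _ = refl
    complete {zero}  {suc v} _  _  r = contradiction r (alone v)
    complete {suc u} {zero}  _  _  r = contradiction (sym r) (alone u)
    complete {suc u} {suc v} ru rv r = cong suc (R⇒class-≡ ru rv r)

classes : ∀ {N} {R : Rel (Fin N) 0ℓ} → (∀ u v → Dec (R u v)) → Symmetric R → Transitive R → Classes R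
classes {zero} _ _ _ = record
  { k = 0 ; class = λ { {()} } ; class-surjective = λ ()
  ; class-≡⇒R = λ { {()} } ; R⇒class-≡ = λ { {()} } }
classes {suc N} R? sym trans
  with R? zero zero | any? (λ j → R? zero (suc j)) | classes (λ u v → R? (suc u) (suc v)) sym trans
... | no ¬r00 | _          | rest = extend-joining sym trans rest (λ r00 → contradiction r00 ¬r00)
... | yes _   | yes linked | rest = extend-joining sym trans rest (λ _ → linked)
... | yes r00 | no ¬linked | rest = extend-singleton sym trans rest r00 (λ j r → ¬linked (j , r))

module _ (G : Graph) where
  open Graph G

  private
    variable
      e : Fin m
      u v w x y : Fin n
      X : Pred (Fin n) 0ℓ

  Joins-sym : Joins G e u w → Joins G e w u
  Joins-sym (inj₁ ends≡) = inj₂ ends≡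
  Joins-sym (inj₂ ends≡) = inj₁ ends≡

  Joins? : ∀ e u w → Dec (Joins G e u w)
  Joins? e u w = (proj₁ (ends e) ≟ u ×-dec proj₂ (ends e) ≟ w) ⊎-dec (proj₁ (ends e) ≟ w ×-dec proj₂ (ends e) ≟ u)

  Joins⇒≢ : Joins G e u w → u ≢ w
  Joins⇒≢ {e} (inj₁ (≡u , ≡w)) u≡w = loopless e (trans ≡u (trans u≡w (sym ≡w)))
  Joins⇒≢ {e} (inj₂ (≡w , ≡u)) u≡w = loopless e (trans ≡w (trans (sym u≡w) (sym ≡u)))

  Joins⇒Incident : Joins G e u w → Incident G e u
  Joins⇒Incident (inj₁ (≡u , _)) = inj₁ ≡u
  Joins⇒Incident (inj₂ (_ , ≡u)) = inj₂ ≡u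

  Reach-source : Reach G X u v → X u
  Reach-source (here xu)       = xu
  Reach-source (step _ xu _ _) = xu

  Reach-target : Reach G X u v → X v
  Reach-target (here xv)       = xv
  Reach-target (step _ _ _ r) = Reach-target r

  Reach-snoc : Reach G X u w → Joins G e w v → X v → Reach G X u v
  Reach-snoc (here xu)          uv xv = step _ xu uv (here xv)
  Reach-snoc (step e′ xu uw′ r) wv xv = step e′ xu uw′ (Reach-snoc r wv xv)

  Reach-trans : Reach G X u w → Reach G X w v → Reach G X u v
  Reach-trans (here _)          r′ = r′
  Reach-trans (step e xu uw′ r) r′ = step e xu uw′ (Reach-trans r r′)

  Reach-sym : Reach G X u v → Reach G X v u
  Reach-sym (here xu)         = here xu
  Reach-sym (step e xu uw r) = Reach-snoc (Reach-sym r) (Joins-sym uw) xu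

  module _ {X : Pred (Fin n) 0ℓ} (X? : Decidable X) (u : Fin n) where

    Reach≤ : ℕ → Fin n → Set
    Reach≤ zero    v = v ≡ u × X u
    Reach≤ (suc k) v = Reach≤ k v ⊎ (X v × ∃₂ λ e w → Reach≤ k w × Joins G e w v)

    Reach≤? : ∀ k v → Dec (Reach≤ k v)
    Reach≤? zero    v = v ≟ u ×-dec X? u
    Reach≤? (suc k) v = Reach≤? k v ⊎-dec (X? v ×-dec any? λ e → any? λ w → Reach≤? k w ×-dec Joins? e w v)

    Reach≤⇒Reach : ∀ k → Reach≤ k v → Reach G X u v
    Reach≤⇒Reach zero    (refl , xu)                = here xu
    Reach≤⇒Reach (suc k) (inj₁ r)                   = Reach≤⇒Reach k r
    Reach≤⇒Reach (suc k) (inj₂ (xv , e , w , r , wv)) = Reach-snoc (Reach≤⇒Reach k r) wv xv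

    Reach≤-mono : ∀ {j k} → j ≤ k → Reach≤ j v → Reach≤ k v
    Reach≤-mono {k = zero}  z≤n r = r
    Reach≤-mono {k = suc k} j≤1+k r with m≤n⇒m<n∨m≡n j≤1+k
    ... | inj₁ (s≤s j≤k) = inj₁ (Reach≤-mono j≤k r)
    ... | inj₂ refl      = r

    Stable : ℕ → Set
    Stable k = ∀ v → Reach≤ (suc k) v → Reach≤ k v

    Stable⇒Reach⇒Reach≤ : ∀ {k} → Stable k → Reach≤ k x → Reach G X x v → Reach≤ k v
    Stable⇒Reach⇒Reach≤ stable r (here _)           = r
    Stable⇒Reach⇒Reach≤ stable r (step e _ xw rest) =
      Stable⇒Reach⇒Reach≤ stable (stable _ (inj₂ (Reach-source rest , e , _ , r , xw))) rest

    -- Each unstable level adds a new vertex, so one of the first n + 1 levels is stable.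
    stable : ∃ Stable
    stable with any? (λ (i : Fin (suc n)) → all? λ v → Reach≤? (suc (toℕ i)) v →-dec Reach≤? (toℕ i) v)
    ... | yes (i , st) = toℕ i , st
    ... | no ¬st = contradiction (pigeonhole (n<1+n n) new) all-distinct
      where
      new-at : ∀ i → ∃ λ v → Reach≤ (suc (toℕ i)) v × ¬ Reach≤ (toℕ i) v
      new-at i with any? (λ v → Reach≤? (suc (toℕ i)) v ×-dec ¬? (Reach≤? (toℕ i) v))
      ... | yes found = found
      ... | no ¬found = contradiction (i , λ v r → decidable-stable (Reach≤? _ v) (λ ¬r → ¬found (v , r , ¬r))) ¬st
      new : Fin (suc n) → Fin n
      new i = proj₁ (new-at i)
      all-distinct : ¬ ∃₂ λ i j → i Data.Fin.< j × new i ≡ new j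
      all-distinct (i , j , i<j , same) =
        proj₂ (proj₂ (new-at j)) (subst (Reach≤ (toℕ j)) same (Reach≤-mono i<j (proj₁ (proj₂ (new-at i)))))

    -- Here and below, heavy constructions are abstract so that type checking never unfolds them.
    abstract
      Reach? : ∀ v → Dec (Reach G X u v)
      Reach? v with stable
      ... | k , st with Reach≤? k v
      ... | yes r = yes (Reach≤⇒Reach k r)
      ... | no ¬r = no λ r → ¬r (Stable⇒Reach⇒Reach≤ st (Reach≤-mono z≤n (refl , Reach-source r)) r)

  crossing-edge : ∀ {C : Pred (Fin n) 0ℓ} → Decidable C → Reach G (λ _ → ⊤) x y → C x → ¬ C y →
                  ∃₂ λ e a → ∃ λ b → Joins G e a b × C a × ¬ C b
  crossing-edge C? (here _) cx ¬cy = contradiction cx ¬cy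
  crossing-edge C? (step {w = w} e _ xw rest) cx ¬cy with C? w
  ... | yes cw = crossing-edge C? rest cw ¬cy
  ... | no ¬cw = e , _ , w , xw , cx , ¬cw

∈tabulate⁻ : ∀ {k} {f : Fin k → _} {i} → i ∈ tabulate f → f i ≡ true
∈tabulate⁻ {f = f} {i} i∈ = trans (sym (lookup∘tabulate f i)) ([]=⇒lookup i∈)

∈tabulate⁺ : ∀ {k} {f : Fin k → _} {i} → f i ≡ true → i ∈ tabulate f
∈tabulate⁺ {f = f} {i} fi = lookup⇒[]= i _ (trans (lookup∘tabulate f i) fi)

∈tabulate-dec⁻ : ∀ {k} {P : Pred (Fin k) 0ℓ} (P? : Decidable P) {i} → i ∈ tabulate (λ j → ⌊ P? j ⌋) → P i
∈tabulate-dec⁻ P? {i} i∈ with P? i | ∈tabulate⁻ i∈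
... | yes p | _ = p

∈tabulate-dec⁺ : ∀ {k} {P : Pred (Fin k) 0ℓ} (P? : Decidable P) {i} → P i → i ∈ tabulate (λ j → ⌊ P? j ⌋)
∈tabulate-dec⁺ P? {i} p = ∈tabulate⁺ (trans (isYes≗does (P? i)) (dec-true (P? i) p))

module _ (G : Graph) where
  open Graph G

  private
    variable
      e : Fin m
      u v w : Fin n

  Joins⇒Incident⇒≡ : ∀ {x} → Joins G e u w → Incident G e x → x ≡ u ⊎ x ≡ w
  Joins⇒Incident⇒≡ (inj₁ (≡u , ≡w)) (inj₁ ≡x) = inj₁ (trans (sym ≡x) ≡u)
  Joins⇒Incident⇒≡ (inj₁ (≡u , ≡w)) (inj₂ ≡x) = inj₂ (trans (sym ≡x) ≡w)
  Joins⇒Incident⇒≡ (inj₂ (≡w , ≡u)) (inj₁ ≡x) = inj₂ (trans (sym ≡x) ≡w)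
  Joins⇒Incident⇒≡ (inj₂ (≡w , ≡u)) (inj₂ ≡x) = inj₁ (trans (sym ≡x) ≡u)

  opposite : Fin m → Fin n → Fin n
  opposite e v with proj₁ (ends e) ≟ v
  ... | yes _ = proj₂ (ends e)
  ... | no _  = proj₁ (ends e)

  Incident⇒Joins-opposite : Incident G e v → Joins G e v (opposite e v)
  Incident⇒Joins-opposite {e} {v} e∋v with proj₁ (ends e) ≟ v | e∋v
  ... | yes ≡v | _      = inj₁ (≡v , refl)
  ... | no ≢v  | inj₁ ≡v = contradiction ≡v ≢v
  ... | no _   | inj₂ ≡v = inj₂ (refl , ≡v)

  Joins⇒≡opposite : Joins G e v w → w ≡ opposite e v
  Joins⇒≡opposite {e} {v} {w} e∋vw with proj₁ (ends e) ≟ v | e∋vw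
  ... | yes _   | inj₁ (_ , ≡w)  = sym ≡w
  ... | yes ≡v  | inj₂ (_ , ≡v′) = contradiction (trans ≡v (sym ≡v′)) (loopless e)
  ... | no ≢v   | inj₁ (≡v , _)  = contradiction ≡v ≢v
  ... | no _    | inj₂ (≡w , _)  = sym ≡w

  record PerfectMatching : Set where
    field
      edges : Subset m
      isPerfectMatching : IsPerfectMatching G edges

    matchEdge : Fin n → Fin m
    matchEdge v = proj₁ (proj₁ (proj₂ isPerfectMatching) v tt)

    matchEdge∈edges : ∀ v → matchEdge v ∈ edges
    matchEdge∈edges v = proj₁ (proj₂ (proj₁ (proj₂ isPerfectMatching) v tt))

    partner : Fin n → Fin n
    partner v = opposite (matchEdge v) v

    matchEdge-joins : ∀ v → Joins G (matchEdge v) v (partner v)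
    matchEdge-joins v = Incident⇒Joins-opposite (proj₂ (proj₂ (proj₁ (proj₂ isPerfectMatching) v tt)))

    matchEdge-unique : e ∈ edges → Incident G e v → e ≡ matchEdge v
    matchEdge-unique {e} {v} e∈ e∋v =
      proj₂ (proj₂ isPerfectMatching) v e (matchEdge v) e∈ (matchEdge∈edges v) e∋v
        (Joins⇒Incident G (matchEdge-joins v))

    ∈edges⇒partner : e ∈ edges → Joins G e v w → partner v ≡ w
    ∈edges⇒partner {e} {v} e∈ e∋vw =
      trans (cong (λ e′ → opposite e′ v) (sym (matchEdge-unique e∈ (Joins⇒Incident G e∋vw))))
            (sym (Joins⇒≡opposite e∋vw))

    partner-involutive : ∀ v → partner (partner v) ≡ v
    partner-involutive v = ∈edges⇒partner (matchEdge∈edges v) (Joins-sym G (matchEdge-joins v))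

    partner-swap : ∀ {v w} → partner v ≡ w → partner w ≡ v
    partner-swap {v} refl = partner-involutive v

    partner-injective : ∀ {u v} → partner u ≡ partner v → u ≡ v
    partner-injective {u} {v} eq =
      trans (sym (partner-involutive u)) (trans (cong partner eq) (partner-involutive v))

    partner-≢ : ∀ v → partner v ≢ v
    partner-≢ v = Joins⇒≢ G (matchEdge-joins v) ∘ sym

    matchEdge-partner : ∀ v → matchEdge (partner v) ≡ matchEdge v
    matchEdge-partner v =
      sym (matchEdge-unique (matchEdge∈edges v) (Joins⇒Incident G (Joins-sym G (matchEdge-joins v))))

  open PerfectMatching

  module _ {I : Set} (M : I → PerfectMatching) (select : Fin n → I)
           {Y : Pred (Fin n) 0ℓ} (Y? : Decidable Y)
           (partner-Y : ∀ {v} → Y v → Y (partner (M (select v)) v))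
           (partner-select : ∀ {v} → Y v → select (partner (M (select v)) v) ≡ select v) where

    private
      σ : Fin n → Fin n
      σ v = partner (M (select v)) v
      ε : Fin n → Fin m
      ε v = matchEdge (M (select v)) v

      ε-σ : ∀ {v} → Y v → ε (σ v) ≡ ε v
      ε-σ {v} yv = trans (cong (λ i → matchEdge (M i) (σ v)) (partner-select yv)) (matchEdge-partner (M (select v)) v)

      MatchEdgeIn : Fin m → Set
      MatchEdgeIn e = ∃ λ w → Y w × ε w ≡ e

      patched : Subset m
      patched = tabulate λ e → ⌊ any? (λ w → Y? w ×-dec ε w ≟ e) ⌋

      ∈patched⁻ : e ∈ patched → MatchEdgeIn e
      ∈patched⁻ e∈ = ∈tabulate-dec⁻ (λ e → any? (λ w → Y? w ×-dec ε w ≟ e)) e∈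

      ∈patched⁺ : MatchEdgeIn e → e ∈ patched
      ∈patched⁺ = ∈tabulate-dec⁺ (λ e → any? (λ w → Y? w ×-dec ε w ≟ e))

      ends-Y : e ∈ patched → Y (proj₁ (ends e)) × Y (proj₂ (ends e))
      ends-Y e∈ with ∈patched⁻ e∈
      ... | w , yw , refl with matchEdge-joins (M (select w)) w
      ... | inj₁ (≡w , ≡σw) = subst Y (sym ≡w) yw , subst Y (sym ≡σw) (partner-Y yw)
      ... | inj₂ (≡σw , ≡w) = subst Y (sym ≡σw) (partner-Y yw) , subst Y (sym ≡w) yw

      covered : ∀ v → Y v → ∃[ e ] (e ∈ patched × Incident G e v)
      covered v yv = ε v , ∈patched⁺ (v , yv , refl) , Joins⇒Incident G (matchEdge-joins (M (select v)) v)

      unique : e ∈ patched → Incident G e v → e ≡ ε v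
      unique {v = v} e∈ e∋v with ∈patched⁻ e∈
      ... | w , yw , refl with Joins⇒Incident⇒≡ (matchEdge-joins (M (select w)) w) e∋v
      ... | inj₁ refl = refl
      ... | inj₂ refl = sym (ε-σ yw)

    patchedMatching : ∃[ M ] PerfectMatchingOn G Y M
    patchedMatching = patched , (λ _ → ends-Y) , covered ,
      λ v e e′ e∈ e′∈ e∋v e′∋v → trans (unique e∈ e∋v) (sym (unique e′∈ e′∋v))

module _ (G : Graph) where
  open Graph G

  2∣⇒isOdd≡false : ∀ {j} → 2 ∣ j → isOdd G j ≡ false
  2∣⇒isOdd≡false (divides q refl) = even q
    where
    even : ∀ q → isOdd G (q * 2) ≡ false
    even zero    = refl
    even (suc q) = trans (not-involutive _) (even q)

  2∣1+⇒isOdd≡true : ∀ {j} → 2 ∣ suc j → isOdd G j ≡ true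
  2∣1+⇒isOdd≡true 2∣1+j = not-injective (2∣⇒isOdd≡false 2∣1+j)

  isOdd≡false⇒double : ∀ {j} → isOdd G j ≡ false → ∃ λ h → j ≡ 2 * h
  isOdd≡false⇒double {zero}        _    = 0 , refl
  isOdd≡false⇒double {suc zero}    ()
  isOdd≡false⇒double {suc (suc j)} even =
    let h , j≡2h = isOdd≡false⇒double {j} (trans (sym (not-involutive (isOdd G j))) even)
    in suc h , trans (cong (2 +_) j≡2h) (sym (*-suc 2 h))

  abstract
    componentClasses : ∀ B → Classes (Reach G (Outside G B))
    componentClasses B = classes (Reach? G (λ v → ¬? (v ∈? B))) (Reach-sym G) (Reach-trans G)

  componentLabelling : ∀ B {v} → v ∉ B → ∃₂ λ k c → ComponentLabelling G B k c
  componentLabelling B {v₀} v₀∉B = k , c , surjective , λ u v u∉B v∉B → sound u∉B v∉B , complete u∉B v∉B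
    where
    X? = λ v → ¬? (v ∈? B)
    open Classes (componentClasses B)
    c : Fin n → Fin k
    c v with X? v
    ... | yes v∉B = class (here v∉B)
    ... | no _    = class (here v₀∉B)
    c≡class : ∀ {v} (v∉B : v ∉ B) → c v ≡ class (here v∉B)
    c≡class {v} v∉B with X? v
    ... | yes v∉B′ = R⇒class-≡ _ _ (here v∉B′)
    ... | no v∈B   = contradiction v∉B v∈B
    surjective : ∀ i → ∃[ v ] (v ∉ B × c v ≡ i)
    surjective i with class-surjective i
    ... | v , r , refl = v , Reach-source G r , trans (c≡class (Reach-source G r)) (R⇒class-≡ _ _ r)
    sound : ∀ {u v} (u∉B : u ∉ B) (v∉B : v ∉ B) → c u ≡ c v → Reach G (Outside G B) u v
    sound u∉B v∉B eq = class-≡⇒R _ _ (trans (sym (c≡class u∉B)) (trans eq (c≡class v∉B)))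
    complete : ∀ {u v} (u∉B : u ∉ B) (v∉B : v ∉ B) → Reach G (Outside G B) u v → c u ≡ c v
    complete u∉B v∉B r = trans (c≡class u∉B) (trans (R⇒class-≡ _ _ r) (sym (c≡class v∉B)))

  module ComponentParity (M : PerfectMatching G) {B : Subset n} {k : ℕ} {c : Fin n → Fin k}
                         (labelling : ComponentLabelling G B k c) where
    open PerfectMatching M

    K : Fin k → Subset n
    K = componentOf G B c

    ∈K⁻ : ∀ {v i} → v ∈ K i → v ∉ B × c v ≡ i
    ∈K⁻ {v} {i} v∈K = lemma (lookup B v) (c v ≟ i) refl (∈tabulate⁻ v∈K)
      where
      lemma : ∀ b (d : Dec (c v ≡ i)) → lookup B v ≡ b → not b ∧ ⌊ d ⌋ ≡ true → v ∉ B × c v ≡ i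
      lemma false (yes cv≡i) Bv≡false _ = (λ v∈B → contradiction (trans (sym ([]=⇒lookup v∈B)) Bv≡false) λ ()) , cv≡i

    ∈K⁺ : ∀ {v i} → v ∉ B → c v ≡ i → v ∈ K i
    ∈K⁺ {v} {i} v∉B cv≡i = ∈tabulate⁺ (lemma (lookup B v) refl)
      where
      lemma : ∀ b → lookup B v ≡ b → not b ∧ ⌊ c v ≟ i ⌋ ≡ true
      lemma false _ with c v ≟ i
      ... | yes _ = refl
      ... | no cv≢i = contradiction cv≡i cv≢i
      lemma true  Bv≡true = contradiction (lookup⇒[]= v B Bv≡true) v∉B

    partner-same-class : ∀ {v} → v ∉ B → partner v ∉ B → c (partner v) ≡ c v
    partner-same-class {v} v∉B pv∉B =
      sym (proj₂ (proj₂ labelling v (partner v) v∉B pv∉B) (step (matchEdge v) v∉B (matchEdge-joins v) (here pv∉B)))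

    partner∈K⊎B : ∀ {v i} → v ∈ K i → partner v ∈ K i ⊎ partner v ∈ B
    partner∈K⊎B {v} v∈K with partner v ∈? B | ∈K⁻ v∈K
    ... | yes pv∈B | _             = inj₂ pv∈B
    ... | no pv∉B  | v∉B , cv≡i = inj₁ (∈K⁺ pv∉B (trans (partner-same-class v∉B pv∉B) cv≡i))

    unmatched⇒even : ∀ {i} → (∀ {w} → w ∈ B → partner w ∉ K i) → isOdd G ∣ K i ∣ ≡ false
    unmatched⇒even {i} unmatched = 2∣⇒isOdd≡false (Closed⇒2∣∣p∣ partner partner-involutive partner-≢ closed)
      where
      closed : ∀ {v} → v ∈ K i → partner v ∈ K i
      closed {v} v∈K with partner∈K⊎B v∈K
      ... | inj₁ pv∈K = pv∈K
      ... | inj₂ pv∈B = contradiction (subst (_∈ K i) (sym (partner-involutive v)) v∈K) (unmatched pv∈B)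

    matched-once⇒odd : ∀ {i z} → z ∈ B → partner z ∈ K i → (∀ {w} → w ∈ B → partner w ∈ K i → w ≡ z) →
                       isOdd G ∣ K i ∣ ≡ true
    matched-once⇒odd {i} {z} z∈B pz∈K only-z =
      2∣1+⇒isOdd≡true (subst (2 ∣_) (x∉p⇒∣p∪⁅x⁆∣≡1+∣p∣ z∉K) (Closed⇒2∣∣p∣ partner partner-involutive partner-≢ closed))
      where
      z∉K : z ∉ K i
      z∉K z∈K = proj₁ (∈K⁻ z∈K) z∈B
      closed : ∀ {v} → v ∈ K i ∪ ⁅ z ⁆ → partner v ∈ K i ∪ ⁅ z ⁆
      closed {v} v∈ with x∈p∪q⁻ (K i) ⁅ z ⁆ v∈
      ... | inj₂ v∈⁅z⁆ rewrite x∈⁅y⁆⇒x≡y z v∈⁅z⁆ = x∈p∪q⁺ (inj₁ pz∈K)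
      ... | inj₁ v∈K with partner∈K⊎B v∈K
      ...   | inj₁ pv∈K = x∈p∪q⁺ (inj₁ pv∈K)
      ...   | inj₂ pv∈B = x∈p∪q⁺ (inj₂ (subst (_∈ ⁅ z ⁆) (sym pv≡z) (x∈⁅x⁆ z)))
        where pv≡z = only-z pv∈B (subst (_∈ K i) (sym (partner-involutive v)) v∈K)

  module _ {s t : Fin n} (s≢t : s ≢ t) (M : PerfectMatching G) where
    open PerfectMatching M

    private
      S : Subset n
      S = ⁅ s ⁆ ∪ ⁅ t ⁆

    pairBarrier : partner s ∉ S → partner t ∉ S → ¬ Reach G (Outside G S) (partner s) (partner t) → Barrier G S
    pairBarrier ps∉S pt∉S ¬reach with componentLabelling S ps∉S
    ... | k , c , labelling = k , c , labelling ,
      trans (cong ∣_∣ odd≡⁅a⁆∪⁅b⁆) (trans (∣⁅x⁆∪⁅y⁆∣≡2 a≢b) (sym (∣⁅x⁆∪⁅y⁆∣≡2 s≢t)))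
      where
      open ComponentParity M labelling
      partner∉S : ∀ {z} → z ∈ S → partner z ∉ S
      partner∉S z∈S with z∈⁅x⁆∪⁅y⁆⇒z≡x⊎z≡y z∈S
      ... | inj₁ refl = ps∉S
      ... | inj₂ refl = pt∉S
      same-class⇒≡ : ∀ {w z} → w ∈ S → z ∈ S → c (partner w) ≡ c (partner z) → w ≡ z
      same-class⇒≡ w∈S z∈S eq with z∈⁅x⁆∪⁅y⁆⇒z≡x⊎z≡y w∈S | z∈⁅x⁆∪⁅y⁆⇒z≡x⊎z≡y z∈S
      ... | inj₁ refl | inj₁ refl = refl
      ... | inj₂ refl | inj₂ refl = refl
      ... | inj₁ refl | inj₂ refl = contradiction (proj₁ (proj₂ labelling _ _ ps∉S pt∉S) eq) ¬reach
      ... | inj₂ refl | inj₁ refl = contradiction (Reach-sym G (proj₁ (proj₂ labelling _ _ pt∉S ps∉S) eq)) ¬reach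
      a = c (partner s)
      b = c (partner t)
      a≢b : a ≢ b
      a≢b = s≢t ∘ same-class⇒≡ (x∈⁅x⁆∪⁅y⁆ s t) (y∈⁅x⁆∪⁅y⁆ s t)
      odd-at : ∀ {z} → z ∈ S → isOdd G ∣ K (c (partner z)) ∣ ≡ true
      odd-at z∈S = matched-once⇒odd z∈S (∈K⁺ (partner∉S z∈S) refl)
                                       (λ w∈S pw∈K → same-class⇒≡ w∈S z∈S (proj₂ (∈K⁻ pw∈K)))
      only-a-b : ∀ {i} → i ∈ tabulate (λ i → isOdd G ∣ K i ∣) → i ≡ a ⊎ i ≡ b
      only-a-b {i} i∈ with i ≟ a | i ≟ b
      ... | yes i≡a | _       = inj₁ i≡a
      ... | no _    | yes i≡b = inj₂ i≡b
      ... | no i≢a  | no i≢b  = contradiction (trans (sym (∈tabulate⁻ i∈)) (unmatched⇒even unmatched)) λ ()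
        where
        unmatched : ∀ {w} → w ∈ S → partner w ∉ K i
        unmatched w∈S pw∈K with z∈⁅x⁆∪⁅y⁆⇒z≡x⊎z≡y w∈S
        ... | inj₁ refl = i≢a (sym (proj₂ (∈K⁻ pw∈K)))
        ... | inj₂ refl = i≢b (sym (proj₂ (∈K⁻ pw∈K)))
      odd≡⁅a⁆∪⁅b⁆ : tabulate (λ i → isOdd G ∣ K i ∣) ≡ ⁅ a ⁆ ∪ ⁅ b ⁆
      odd≡⁅a⁆∪⁅b⁆ = p≡⁅x⁆∪⁅y⁆ (∈tabulate⁺ (odd-at (x∈⁅x⁆∪⁅y⁆ s t))) (∈tabulate⁺ (odd-at (y∈⁅x⁆∪⁅y⁆ s t))) only-a-b

module _ (G : Graph) where
  open Graph G
  open PerfectMatching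

  record AlternatingPath (C : Pred (Fin n) 0ℓ) (s t : Fin n) (A : PerfectMatching G) : Set where
    field
      len : ℕ
      len-odd : ∃ λ h → len ≡ suc (2 * h)
      path : Path G len s t

    open Path path

    OnPath : Fin n → Set
    OnPath v = ∃ λ i → verts i ≡ v

    field
      verts-in : ∀ i → C (verts i) ⊎ verts i ≡ s ⊎ verts i ≡ t
      edges-touch : ∀ i → C (verts (inject₁ i)) ⊎ C (verts (suc i))
      off-path-closed : ∀ {v} → C v → ¬ OnPath v → C (partner A v) × ¬ OnPath (partner A v)

  module Alternating {C : Pred (Fin n) 0ℓ} {s t : Fin n} (s≢t : s ≢ t) (s∉C : ¬ C s) (t∉C : ¬ C t)
                     (A B : PerfectMatching G) (As∈C : C (partner A s))
                     (A-step : ∀ {v} → C v → C (partner A v) ⊎ partner A v ≡ s ⊎ partner A v ≡ t)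
                     (B-closed : ∀ {v} → C v → C (partner B v)) where

    matching : Bool → PerfectMatching G
    matching false = A
    matching true  = B

    σ : Bool → Fin n → Fin n
    σ b = partner (matching b)

    walk : ℕ → Fin n
    walk zero    = s
    walk (suc l) = σ (isOdd G l) (walk l)

    Inside : ℕ → Set
    Inside L = ∀ {l} → suc l < L → C (walk (suc l))

    walk-distinct : ∀ {L} → Inside L → ∀ b a → a < b → b < L → walk a ≢ walk b
    walk-distinct inC (suc b) zero    _         b<L s≡ = s∉C (subst C (sym s≡) (inC b<L))
    walk-distinct inC (suc b) (suc a) (s≤s a<b) b<L eq with isOdd G a ≟ᵇ isOdd G b
    ... | yes same = walk-distinct inC b a a<b (<-trans (n<1+n b) b<L)
                       (partner-injective (matching (isOdd G b)) (subst (λ x → σ x (walk a) ≡ _) same eq))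
    ... | no differ with m≤n⇒m<n∨m≡n a<b
    ...   | inj₂ refl = partner-≢ (matching (isOdd G b)) (walk b) (sym eq)
    ...   | inj₁ 1+a<b with m≤n⇒m<n∨m≡n 1+a<b
    ...     | inj₂ refl  = differ (sym (not-involutive _))
    ...     | inj₁ 2+a<b = walk-distinct inC b (suc (suc a)) 2+a<b (<-trans (n<1+n b) b<L) back
      where
      back : walk (suc (suc a)) ≡ walk b
      back = begin
        σ (not (isOdd G a)) (walk (suc a)) ≡⟨ cong (λ x → σ x (walk (suc a))) (sym (¬-not (differ ∘ sym))) ⟩
        σ (isOdd G b) (walk (suc a))       ≡⟨ cong (σ (isOdd G b)) eq ⟩
        σ (isOdd G b) (walk (suc b))       ≡⟨ partner-involutive (matching (isOdd G b)) (walk b) ⟩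
        walk b                             ∎
        where open ≡-Reasoning

    step-inside : ∀ b {v} → C v → σ b v ≢ s → σ b v ≢ t → C (σ b v)
    step-inside false cv ≢s ≢t with A-step cv
    ... | inj₁ c        = c
    ... | inj₂ (inj₁ ≡s) = contradiction ≡s ≢s
    ... | inj₂ (inj₂ ≡t) = contradiction ≡t ≢t
    step-inside true  cv _  _  = B-closed cv

    Exit : Set
    Exit = ∃ λ L → (walk (suc L) ≡ s ⊎ walk (suc L) ≡ t) × Inside (suc L)

    exit-or-inside : ∀ j → Exit ⊎ Inside (suc (suc j))
    exit-or-inside zero = inj₂ λ { {zero} _ → As∈C ; {suc l} (s≤s (s≤s ())) }
    exit-or-inside (suc j) with exit-or-inside j
    ... | inj₁ exit = inj₁ exit
    ... | inj₂ inC with walk (suc (suc j)) ≟ s | walk (suc (suc j)) ≟ t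
    ...   | yes ≡s | _      = inj₁ (suc j , inj₁ ≡s , inC)
    ...   | no _   | yes ≡t = inj₁ (suc j , inj₂ ≡t , inC)
    ...   | no ≢s  | no ≢t  = inj₂ inside′
      where
      inside′ : Inside (suc (suc (suc j)))
      inside′ l<3+j with m≤n⇒m<n∨m≡n (s≤s⁻¹ l<3+j)
      ... | inj₁ l<2+j = inC l<2+j
      ... | inj₂ refl  = step-inside (isOdd G (suc j)) (inC ≤-refl) ≢s ≢t

    -- The walk cannot stay in C for n + 1 steps, as its vertices there are distinct.
    exit : Exit
    exit with exit-or-inside n
    ... | inj₁ e      = e
    ... | inj₂ inC with pigeonhole (n<1+n n) (λ (i : Fin (suc n)) → walk (suc (toℕ i)))
    ...   | i , j , i<j , same = contradiction same (walk-distinct inC _ _ (s≤s i<j) (s≤s (toℕ<n j)))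

    ¬s⊎t : ∀ {v} → C v → ¬ (v ≡ s ⊎ v ≡ t)
    ¬s⊎t cv (inj₁ refl) = s∉C cv
    ¬s⊎t cv (inj₂ refl) = t∉C cv

    leaves-by-A : ∀ b {v} → C v → σ b v ≡ s ⊎ σ b v ≡ t → b ≡ false
    leaves-by-A false _  _    = refl
    leaves-by-A true  cv hits = contradiction hits (¬s⊎t (B-closed cv))

    record Arrival : Set where
      field
        L′ : ℕ
        L′-even : isOdd G L′ ≡ false
        reaches-t : walk (suc L′) ≡ t
        stays-inside : Inside (suc L′)

    -- The walk leaves C by an A-edge, and not towards s, which A already matches to walk 1.
    arrival : Arrival
    arrival with exit
    ... | zero , hits , _ = contradiction hits (¬s⊎t As∈C)
    ... | suc L″ , hits , inC =
      record { L′ = suc L″ ; L′-even = even ; reaches-t = at-t hits ; stays-inside = inC }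
      where
      even : isOdd G (suc L″) ≡ false
      even = leaves-by-A _ (inC ≤-refl) hits
      at-t : walk (suc (suc L″)) ≡ s ⊎ walk (suc (suc L″)) ≡ t → walk (suc (suc L″)) ≡ t
      at-t (inj₂ ≡t) = ≡t
      at-t (inj₁ ≡s) = contradiction (partner-swap A A≡s) (distinct L″ even ≤-refl)
        where
        A≡s : partner A (walk (suc L″)) ≡ s
        A≡s = subst (λ b → σ b (walk (suc L″)) ≡ s) even ≡s
        distinct : ∀ l → isOdd G (suc l) ≡ false → suc l < suc (suc L″) → walk 1 ≢ walk (suc l)
        distinct zero    ()
        distinct (suc l) _ 2+l<2+L″ = walk-distinct inC (suc (suc l)) 1 (s≤s (s≤s z≤n)) 2+l<2+L″

    open Arrival arrival

    L : ℕ
    L = suc L′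

    walk-distinct-≤ : ∀ {a b} → a < b → b ≤ L → walk a ≢ walk b
    walk-distinct-≤ {a} {b} a<b b≤L with m≤n⇒m<n∨m≡n b≤L
    ... | inj₁ b<L = walk-distinct stays-inside b a a<b b<L
    ... | inj₂ refl with a
    ...   | zero   = λ s≡ → s≢t (trans s≡ reaches-t)
    ...   | suc a′ = λ ≡walk-L → t∉C (subst C (trans ≡walk-L reaches-t) (stays-inside a<b))

    walk-injective : ∀ {a b} → a ≤ L → b ≤ L → walk a ≡ walk b → a ≡ b
    walk-injective {a} {b} a≤L b≤L eq with <-cmp a b
    ... | tri< a<b _ _ = contradiction eq (walk-distinct-≤ a<b b≤L)
    ... | tri≈ _ a≡b _ = a≡b
    ... | tri> _ _ b<a = contradiction (sym eq) (walk-distinct-≤ b<a a≤L)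

    walk-in : ∀ {a} → a ≤ L → C (walk a) ⊎ walk a ≡ s ⊎ walk a ≡ t
    walk-in {zero}  _    = inj₂ (inj₁ refl)
    walk-in {suc a} a<L with m≤n⇒m<n∨m≡n a<L
    ... | inj₁ 1+a<L = inj₁ (stays-inside 1+a<L)
    ... | inj₂ refl  = inj₂ (inj₂ reaches-t)

    edge-touches : ∀ {l} → l < L → C (walk l) ⊎ C (walk (suc l))
    edge-touches {zero}  _   = inj₂ As∈C
    edge-touches {suc l} l<L = inj₁ (stays-inside l<L)

    OnWalk : Fin n → Set
    OnWalk v = ∃ λ a → a ≤ L × walk a ≡ v

    -- A matches the walk in consecutive pairs (walk 0, walk 1), (walk 2, walk 3), ...
    A-partner-on-walk : ∀ {a} → a ≤ L → OnWalk (partner A (walk a))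
    A-partner-on-walk {a} a≤L with isOdd G a in parity
    ... | false = suc a , ≤∧≢⇒< a≤L a≢L , cong (λ b → σ b (walk a)) parity
      where
      a≢L : a ≢ L
      a≢L refl = contradiction (trans (sym parity) (cong not L′-even)) λ ()
    ... | true  = predecessor a≤L parity
      where
      predecessor : ∀ {a} → a ≤ L → isOdd G a ≡ true → OnWalk (partner A (walk a))
      predecessor {suc a} 1+a≤L odd = a , ≤-trans (n≤1+n a) 1+a≤L , sym (begin
        partner A (σ (isOdd G a) (walk a)) ≡⟨ cong (λ b → partner A (σ b (walk a))) even ⟩
        partner A (partner A (walk a))     ≡⟨ partner-involutive A (walk a) ⟩
        walk a                             ∎)
        where
        open ≡-Reasoning
        even : isOdd G a ≡ false
        even = trans (sym (not-involutive _)) (cong not odd)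

    off-walk-closed : ∀ {v} → C v → ¬ OnWalk v → C (partner A v) × ¬ OnWalk (partner A v)
    off-walk-closed {v} cv off = in-C , off ∘ back
      where
      back : OnWalk (partner A v) → OnWalk v
      back (a , a≤L , eq) =
        let b , b≤L , eq′ = A-partner-on-walk a≤L
        in b , b≤L , trans eq′ (partner-swap A (sym eq))
      in-C : C (partner A v)
      in-C with A-step cv
      ... | inj₁ c         = c
      ... | inj₂ (inj₁ ≡s) = contradiction (back (0 , z≤n , sym ≡s)) off
      ... | inj₂ (inj₂ ≡t) = contradiction (back (L , ≤-refl , trans reaches-t (sym ≡t))) off

    edge : ℕ → Fin m
    edge l = matchEdge (matching (isOdd G l)) (walk l)

    thePath : Path G L s t
    thePath = record
      { verts = walk ∘ toℕ
      ; verts-inj = λ eq → toℕ-injective (walk-injective (toℕ≤pred[n] _) (toℕ≤pred[n] _) eq)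
      ; start = refl
      ; finish = trans (cong walk (toℕ-fromℕ L)) reaches-t
      ; edges = edge ∘ toℕ
      ; edges-join = λ i → subst (λ l → Joins G (edge (toℕ i)) (walk l) (walk (suc (toℕ i))))
                                 (sym (toℕ-inject₁ i)) (matchEdge-joins (matching (isOdd G (toℕ i))) (walk (toℕ i)))
      }

    alternatingPath : AlternatingPath C s t A
    alternatingPath = record
      { len = L
      ; len-odd = let h , L′≡2h = isOdd≡false⇒double G L′-even in h , cong suc L′≡2h
      ; path = thePath
      ; verts-in = λ i → walk-in (toℕ≤pred[n] i)
      ; edges-touch = λ i → subst (λ l → C (walk l) ⊎ C (walk (suc (toℕ i)))) (sym (toℕ-inject₁ i))
                                  (edge-touches (toℕ<n i))
      ; off-path-closed = λ cv off → let c , off′ = off-walk-closed cv (off ∘ onWalk⇒onPath)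
                                     in c , off′ ∘ onPath⇒onWalk
      }
      where
      onWalk⇒onPath : ∀ {v} → OnWalk v → ∃ λ i → walk (toℕ i) ≡ v
      onWalk⇒onPath (a , a≤L , eq) = fromℕ< (s≤s a≤L) , trans (cong walk (toℕ-fromℕ< (s≤s a≤L))) eq
      onPath⇒onWalk : ∀ {v} → (∃ λ i → walk (toℕ i) ≡ v) → OnWalk v
      onPath⇒onWalk (i , eq) = toℕ i , toℕ≤pred[n] i , eq

module _ (G : Graph) where
  open Graph G
  open PerfectMatching

  module PairSeparation {s t : Fin n} (s≢t : s ≢ t) (mc : MatchingCovered G)
                        (¬barrier : ¬ Barrier G (⁅ s ⁆ ∪ ⁅ t ⁆)) where

    S : Subset n
    S = ⁅ s ⁆ ∪ ⁅ t ⁆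

    s∈S : s ∈ S
    s∈S = x∈⁅x⁆∪⁅y⁆ s t

    t∈S : t ∈ S
    t∈S = y∈⁅x⁆∪⁅y⁆ s t

    X : Fin n → Set
    X = Outside G S

    X? : ∀ v → Dec (X v)
    X? v = ¬? (v ∈? S)

    module _ (M : PerfectMatching G) where

      partner∈S⇒s-t-matched : ∀ {z} → z ∈ S → partner M z ∈ S → partner M s ≡ t
      partner∈S⇒s-t-matched z∈S pz∈S with z∈⁅x⁆∪⁅y⁆⇒z≡x⊎z≡y z∈S | z∈⁅x⁆∪⁅y⁆⇒z≡x⊎z≡y pz∈S
      ... | inj₁ refl | inj₂ pz≡t = pz≡t
      ... | inj₂ refl | inj₁ pt≡s = partner-swap M pt≡s
      ... | inj₁ refl | inj₁ pz≡z = contradiction pz≡z (partner-≢ M s)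
      ... | inj₂ refl | inj₂ pz≡z = contradiction pz≡z (partner-≢ M t)

      s-t-matched⇒partner∈S : partner M s ≡ t → ∀ {z} → z ∈ S → partner M z ∈ S
      s-t-matched⇒partner∈S ps≡t z∈S with z∈⁅x⁆∪⁅y⁆⇒z≡x⊎z≡y z∈S
      ... | inj₁ refl = subst (_∈ S) (sym ps≡t) t∈S
      ... | inj₂ refl = subst (_∈ S) (sym (partner-swap M ps≡t)) s∈S

      partner∉S : ∀ {z w} → z ∈ S → partner M z ∉ S → w ∈ S → partner M w ∉ S
      partner∉S z∈S pz∉S w∈S pw∈S = pz∉S (s-t-matched⇒partner∈S (partner∈S⇒s-t-matched w∈S pw∈S) z∈S)

      partners-joined : partner M s ∉ S → partner M t ∉ S → Reach G X (partner M s) (partner M t)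
      partners-joined ps∉S pt∉S =
        decidable-stable (Reach? G X? (partner M s) (partner M t)) (¬barrier ∘ pairBarrier G s≢t M ps∉S pt∉S)

    record MatchingInto (u : Fin n) : Set where
      field
        matching : PerfectMatching G
        partner-s : Reach G X u (partner matching s)
        partner-t : Reach G X u (partner matching t)

    abstract
      matchingInto : ∀ {u} → u ∉ S → MatchingInto u
      matchingInto {u} u∉S
        with crossing-edge G (Reach? G X? u) (proj₂ (proj₁ mc) u s) (here u∉S) (λ u↝s → Reach-target G u↝s s∈S)
      ... | e , a , b , e∋ab , u↝a , ¬u↝b with b ∈? S | proj₂ mc e
      ...   | no b∉S  | _ = contradiction (Reach-snoc G u↝a e∋ab b∉S) ¬u↝b
      ...   | yes b∈S | edges , isPM , e∈ = into (z∈⁅x⁆∪⁅y⁆⇒z≡x⊎z≡y b∈S)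
        where
        M : PerfectMatching G
        M = record { edges = edges ; isPerfectMatching = isPM }
        u↝pb : Reach G X u (partner M b)
        u↝pb = subst (Reach G X u) (sym (∈edges⇒partner M e∈ (Joins-sym G e∋ab))) u↝a
        pb∉S : partner M b ∉ S
        pb∉S = Reach-target G u↝pb
        ps↝pt : Reach G X (partner M s) (partner M t)
        ps↝pt = partners-joined M (partner∉S M b∈S pb∉S s∈S) (partner∉S M b∈S pb∉S t∈S)
        into : b ≡ s ⊎ b ≡ t → MatchingInto u
        into (inj₁ refl) = record { matching = M ; partner-s = u↝pb ; partner-t = Reach-trans G u↝pb ps↝pt }
        into (inj₂ refl) =
          record { matching = M ; partner-s = Reach-trans G u↝pb (Reach-sym G ps↝pt) ; partner-t = u↝pb }

    threeComponents : AtLeastThreeComponents G S →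
                      ∃ λ (u : Fin 3 → Fin n) → (∀ j → u j ∉ S) × (∀ {i j} → i ≢ j → ¬ Reach G X (u i) (u j))
    threeComponents (u₁ , u₂ , u₃ , u₁∉S , u₂∉S , u₃∉S , ¬u₁↝u₂ , ¬u₁↝u₃ , ¬u₂↝u₃) = u , u∉S , separated
      where
      u : Fin 3 → Fin n
      u zero             = u₁
      u (suc zero)       = u₂
      u (suc (suc zero)) = u₃
      u∉S : ∀ j → u j ∉ S
      u∉S zero             = u₁∉S
      u∉S (suc zero)       = u₂∉S
      u∉S (suc (suc zero)) = u₃∉S
      separated : ∀ {i j} → i ≢ j → ¬ Reach G X (u i) (u j)
      separated {zero}             {zero}             i≢j = contradiction refl i≢j
      separated {suc zero}         {suc zero}         i≢j = contradiction refl i≢j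
      separated {suc (suc zero)}   {suc (suc zero)}   i≢j = contradiction refl i≢j
      separated {zero}             {suc zero}         _   = ¬u₁↝u₂
      separated {zero}             {suc (suc zero)}   _   = ¬u₁↝u₃
      separated {suc zero}         {suc (suc zero)}   _   = ¬u₂↝u₃
      separated {suc zero}         {zero}             _   = ¬u₁↝u₂ ∘ Reach-sym G
      separated {suc (suc zero)}   {zero}             _   = ¬u₁↝u₃ ∘ Reach-sym G
      separated {suc (suc zero)}   {suc zero}         _   = ¬u₂↝u₃ ∘ Reach-sym G

    module ThreeComponents (u : Fin 3 → Fin n) (u∉S : ∀ j → u j ∉ S)
                           (separated : ∀ {i j} → i ≢ j → ¬ Reach G X (u i) (u j)) where

      C : Fin 3 → Fin n → Set
      C j = Reach G X (u j)

      Region : Fin 3 → Fin n → Set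
      Region j v = C j v ⊎ v ≡ s ⊎ v ≡ t

      C∩Region : ∀ {i j v} → i ≢ j → C i v → Region j v → ⊥
      C∩Region i≢j ci (inj₁ cj)         = separated i≢j (Reach-trans G ci (Reach-sym G cj))
      C∩Region _   ci (inj₂ (inj₁ refl)) = Reach-target G ci s∈S
      C∩Region _   ci (inj₂ (inj₂ refl)) = Reach-target G ci t∈S

      M : Fin 3 → PerfectMatching G
      M j = MatchingInto.matching (matchingInto (u∉S j))

      matched-to-S⇒C : ∀ {j v} → partner (M j) v ∈ S → C j v
      matched-to-S⇒C {j} {v} pv∈S with z∈⁅x⁆∪⁅y⁆⇒z≡x⊎z≡y pv∈S
      ... | inj₁ pv≡s = subst (C j) (partner-swap (M j) pv≡s) (MatchingInto.partner-s (matchingInto (u∉S j)))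
      ... | inj₂ pv≡t = subst (C j) (partner-swap (M j) pv≡t) (MatchingInto.partner-t (matchingInto (u∉S j)))

      next : Fin 3 → Fin 3
      next zero             = suc zero
      next (suc zero)       = suc (suc zero)
      next (suc (suc zero)) = zero

      next≢ : ∀ j → next j ≢ j
      next≢ zero             ()
      next≢ (suc zero)       ()
      next≢ (suc (suc zero)) ()

      A-step : ∀ {j v} → C j v → C j (partner (M j) v) ⊎ partner (M j) v ≡ s ⊎ partner (M j) v ≡ t
      A-step {j} {v} cv with partner (M j) v ∈? S
      ... | yes pv∈S = inj₂ (z∈⁅x⁆∪⁅y⁆⇒z≡x⊎z≡y pv∈S)
      ... | no pv∉S  = inj₁ (Reach-snoc G cv (matchEdge-joins (M j) v) pv∉S)

      B-closed : ∀ {j v} → C j v → C j (partner (M (next j)) v)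
      B-closed {j} {v} cv with partner (M (next j)) v ∈? S
      ... | yes pv∈S = contradiction (inj₁ cv) (C∩Region (next≢ j) (matched-to-S⇒C pv∈S))
      ... | no pv∉S  = Reach-snoc G cv (matchEdge-joins (M (next j)) v) pv∉S

      abstract
       P : (j : Fin 3) → AlternatingPath G (C j) s t (M j)
       P j = Alternating.alternatingPath G s≢t (λ cs → Reach-target G cs s∈S) (λ ct → Reach-target G ct t∈S)
               (M j) (M (next j)) (MatchingInto.partner-s (matchingInto (u∉S j))) A-step B-closed

      open AlternatingPath

      vert : (j : Fin 3) → Fin (suc (len (P j))) → Fin n
      vert j = Path.verts (path (P j))

      edge : (j : Fin 3) → Fin (len (P j)) → Fin m
      edge j = Path.edges (path (P j))

      paths-internally-disjoint : ∀ i j → i ≢ j → ∀ a b → vert i a ≡ vert j b → vert i a ≡ s ⊎ vert i a ≡ t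
      paths-internally-disjoint i j i≢j a b same with verts-in (P i) a
      ... | inj₂ s⊎t = s⊎t
      ... | inj₁ c   = ⊥-elim (C∩Region i≢j c (subst (Region j) (sym same) (verts-in (P j) b)))

      edge-ends-in-Region : ∀ i a {x} → Incident G (edge i a) x → Region i x
      edge-ends-in-Region i a e∋x with Joins⇒Incident⇒≡ G (Path.edges-join (path (P i)) a) e∋x
      ... | inj₁ refl = verts-in (P i) (inject₁ a)
      ... | inj₂ refl = verts-in (P i) (suc a)

      paths-edge-disjoint : ∀ i j → i ≢ j → ∀ a b → edge i a ≢ edge j b
      paths-edge-disjoint i j i≢j a b same with edges-touch (P j) b
      ... | inj₁ c = C∩Region (i≢j ∘ sym) c (shared (Joins⇒Incident G b-joins))
        where b-joins = Path.edges-join (path (P j)) b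
              shared = edge-ends-in-Region i a ∘ subst (λ e → Incident G e _) (sym same)
      ... | inj₂ c = C∩Region (i≢j ∘ sym) c (shared (Joins⇒Incident G (Joins-sym G b-joins)))
        where b-joins = Path.edges-join (path (P j)) b
              shared = edge-ends-in-Region i a ∘ subst (λ e → Incident G e _) (sym same)

      OnH : Fin n → Set
      OnH v = ∃[ j ] ∃[ a ] (vert j a ≡ v)

      OnH? : ∀ v → Dec (OnH v)
      OnH? v = any? λ j → any? λ a → vert j a ≟ v

      OnH⇒Region : ∀ {v} → OnH v → ∃ λ j → Region j v
      OnH⇒Region (j , a , refl) = j , verts-in (P j) a

      s∈H : OnH s
      s∈H = zero , zero , Path.start (path (P zero))

      t∈H : OnH t
      t∈H = zero , _ , Path.finish (path (P zero))

      abstract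
        select : Fin n → Fin 3
        select v with any? (λ j → Reach? G X? (u j) v)
        ... | yes (j , _) = j
        ... | no _        = zero

        select-C : ∀ {j v} → C j v → select v ≡ j
        select-C {j} {v} cj with any? (λ j → Reach? G X? (u j) v)
        ... | no none = ⊥-elim (none (j , cj))
        ... | yes (i , ci) with i ≟ j
        ...   | yes i≡j = i≡j
        ...   | no i≢j  = ⊥-elim (C∩Region i≢j ci (inj₁ cj))

        select-none : ∀ {v} → (∀ j → ¬ C j v) → select v ≡ zero
        select-none {v} none with any? (λ j → Reach? G X? (u j) v)
        ... | yes (j , cj) = ⊥-elim (none j cj)
        ... | no _         = refl

      off-H-inside : ∀ {j v} → C j v → ¬ OnH v → C j (partner (M j) v) × ¬ OnH (partner (M j) v)
      off-H-inside {j} {v} cv v∉H = cw , w∉H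
        where
        off-path = off-path-closed (P j) cv (λ (a , same) → v∉H (j , a , same))
        cw = proj₁ off-path
        w∉H : ¬ OnH (partner (M j) v)
        w∉H (i , a , same) with i ≟ j
        ... | yes refl = proj₂ off-path (a , same)
        ... | no i≢j   = C∩Region (i≢j ∘ sym) cw (subst (Region i) same (verts-in (P i) a))

      off-H-outside : ∀ {v} → (∀ j → ¬ C j v) → ¬ OnH v →
                      (∀ j → ¬ C j (partner (M zero) v)) × ¬ OnH (partner (M zero) v)
      off-H-outside {v} ¬C v∉H = ¬C′ , w∉H
        where
        v∉S : v ∉ S
        v∉S v∈S with z∈⁅x⁆∪⁅y⁆⇒z≡x⊎z≡y v∈S
        ... | inj₁ refl = v∉H s∈H
        ... | inj₂ refl = v∉H t∈H
        w = partner (M zero) v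
        w∉S : w ∉ S
        w∉S w∈S = ¬C zero (matched-to-S⇒C w∈S)
        ¬C′ : ∀ j → ¬ C j w
        ¬C′ j cw = ¬C j (Reach-snoc G cw (Joins-sym G (matchEdge-joins (M zero) v)) v∉S)
        w∉H : ¬ OnH w
        w∉H w∈H with OnH⇒Region w∈H
        ... | j , inj₁ cw         = ¬C′ j cw
        ... | _ , inj₂ (inj₁ w≡s) = w∉S (subst (_∈ S) (sym w≡s) s∈S)
        ... | _ , inj₂ (inj₂ w≡t) = w∉S (subst (_∈ S) (sym w≡t) t∈S)

      partner-off-H : ∀ {v} → ¬ OnH v → let w = partner (M (select v)) v in ¬ OnH w × select w ≡ select v
      partner-off-H {v} v∉H with any? (λ j → Reach? G X? (u j) v)
      ... | yes (j , cv) rewrite select-C cv =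
        let cw , w∉H = off-H-inside cv v∉H in w∉H , select-C cw
      ... | no none rewrite select-none (λ j cv → none (j , cv)) =
        let ¬C′ , w∉H = off-H-outside (λ j cv → none (j , cv)) v∉H in w∉H , select-none ¬C′

proposition28 : (G : Graph) (S : Subset (Graph.n G)) → MatchingCovered G → TwoSeparation G S → AtLeastThreeComponents G S → θ-based G
proposition28 G S mc (∣S∣≡2 , _ , ¬barrier) three with ∣p∣≡2⇒p≡⁅x⁆∪⁅y⁆ {p = S} ∣S∣≡2
... | s , t , s≢t , refl with PairSeparation.threeComponents G s≢t mc ¬barrier three
...   | u , u∉S , separated = record
  { a = s ; b = t ; a≢b = s≢t
  ; len = λ j → len (P j)
  ; len-odd = λ j → len-odd (P j)
  ; path = λ j → path (P j)
  ; internally-disjoint = paths-internally-disjoint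
  ; edge-disjoint = paths-edge-disjoint
  ; conformal = patchedMatching G M select (λ v → ¬? (OnH? v)) (proj₁ ∘ partner-off-H) (proj₂ ∘ partner-off-H)
  }
  where
  open PairSeparation G s≢t mc ¬barrier
  open ThreeComponents u u∉S separated
  open AlternatingPath
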